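{- Let $\mathbf{p}=p_1p_2p_3\cdots$ be the regular paperfolding word. Let $n\geq 3$ and let $p=\mathbf{p}[\ell+1,\ldots,\ell+2^n]$ be any factor of $\mathbf{p}$ of length $2^n$, written as $p=u_1v_1u_2v_2\cdots u_{2^{n-1}}v_{2^{n-1}}$ with each $u_i,v_i\in\{0,1\}$. Let $\Phi:\{0,1\}^2\to\{x,y,z\}$ be given by $\Phi(00)=x$, $\Phi(01)=\Phi(10)=y$, $\Phi(11)=z$. Then there is no integer $q$ with $1\le q<2^{n-1}$ such that $$\Phi(u_1v_1)\cdots\Phi(u_{2^{n-1}}v_{2^{n-1}})=\Phi(u_{q+1}v_{q+1})\cdots\Phi(u_{2^{n-1}}v_{2^{n-1}})\Phi(u_1v_1)\cdots\Phi(u_qv_q)$$ (equality of words over $\{x,y,z\}$).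
   Context: Paperfolding words: given a sequence of instructions $\mathbf{b}=b_0b_1b_2\cdots\in\{ -1,1\}^{\mathbb N}$, the associated paperfolding word $\mathbf{f}=f_1f_2\cdots$ over $\{0,1\}$ is defined as follows: for $i\ge1$ write uniquely $i=2^k(2j+1)$; then $f_i=1$ if and only if $i\equiv 2^k(2+b_k)\pmod{2^{k+2}}$, and $f_i=0$ otherwise. The regular paperfolding word is the paperfolding word associated with $\mathbf{b}=1^\omega$ (all $b_k=1$); it begins $00100110001101100010011100110110\cdots$. $\mathbf{p}[\ell+1,\ldots,\ell+n]$ denotes the factor $p_{\ell+1}\cdots p_{\ell+n}$. -}

module Defs where

open import Data.Nat using (ℕ; zero; suc; _+_; _*_; _^_; _%_; _/_; _≡ᵇ_)
open import Data.Bool using (Bool; true; false; if_then_else_)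
open import Data.List using (List; map; drop; take; _++_; upTo)

-- Folding instructions b_k ∈ {-1, 1}
data Sign : Set where
  minus plus : Sign

-- 2 + b_k as a natural number (1 or 3)
twoPlus : Sign → ℕ
twoPlus minus = 1
twoPlus plus  = 3

-- Paperfolding letter f_i for i ≥ 1 (here f i = false means letter 0,
-- true means letter 1).  Writing i = 2^k (2j+1), f_i = 1 iff
-- i ≡ 2^k (2 + b_k) (mod 2^(k+2)), i.e. iff the odd part 2j+1 of i
-- is ≡ 2 + b_k (mod 4).  We compute this by stripping factors of 2
-- while shifting the instruction sequence; the fuel argument (≥ i)
-- only ensures termination.
pfAux : ℕ → (ℕ → Sign) → ℕ → Bool
pfAux zero     b i = false
pfAux (suc fuel) b i with i % 2
... | zero  = pfAux fuel (λ k → b (suc k)) (i / 2)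
... | suc _ = (i % 4) ≡ᵇ twoPlus (b 0)

-- the paperfolding word associated with b; meaningful for i ≥ 1
paperfolding : (ℕ → Sign) → ℕ → Bool
paperfolding b i = pfAux i b i

regularPF : ℕ → Bool
regularPF = paperfolding (λ _ → plus)

data XYZ : Set where
  x y z : XYZ

Φ : Bool → Bool → XYZ
Φ false false = x
Φ false true  = y
Φ true  false = y
Φ true  true  = z

-- For the factor p = p[ℓ+1 .. ℓ+2^n] = u_1 v_1 ⋯ u_M v_M (M = 2^(n-1)):
-- u_i = p_{ℓ+2i-1}, v_i = p_{ℓ+2i}, for i = 1..M.  The word
-- Φ(u_1 v_1) ⋯ Φ(u_M v_M), as a list (index i-1 ↦ Φ(u_i v_i)).
phiWord : (ℓ M : ℕ) → List XYZ
phiWord ℓ M = map (λ i → Φ (regularPF (ℓ + 2 * i + 1)) (regularPF (ℓ + 2 * i + 2))) (upTo M)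

-- If the Φ-image of p were a nontrivial rotation of itself, with q = 2^a(2r+1) and
-- a ≤ n − 2, rotating 2^(n−2−a) times would show that the sequence of pairs is a square
-- uu with |u| = 2^(n−2) pairs, i.e. that Φ-letters agree across a shift by D = 2^(n−1)
-- positions. Any D consecutive positions contain an odd multiple m of D/2, and
-- p_m ≠ p_(m+D), because p_(2^k o) = p_o while p at odd positions alternates with the
-- residue mod 4. But the partner of m in its pair is odd, odd positions are unaffected by
-- the shift since 4 ∣ D, and Φ recovers one letter of a pair from the other: so
-- p_m = p_(m+D).
module Submission where

open import Data.Bool using (true; false)
open import Data.List using (_∷_; map; drop; take; _++_; upTo; applyUpTo)
open import Data.List.Properties using (map-upTo; ∷-injective)
open import Data.Nat
open import Data.Nat.DivMod
open import Data.Nat.Induction using (<-rec)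
open import Data.Nat.Properties
open import Data.Nat.Tactic.RingSolver using (solve-∀)
open import Data.Product using (∃-syntax; _×_; _,_; proj₁; proj₂)
open import Function using (_∘_)
open import Relation.Binary.PropositionalEquality
open import Relation.Nullary using (¬_)

open import Defs

open ≡-Reasoning

data EvenOdd : ℕ → Set where
  even : ∀ m → EvenOdd (2 * m)
  odd  : ∀ m → EvenOdd (1 + 2 * m)

evenOdd : ∀ n → EvenOdd n
evenOdd zero = even 0
evenOdd (suc n) with evenOdd n
... | even m = odd m
... | odd m  = subst EvenOdd (cong suc (+-suc m (m + 0))) (even (suc m))

2*m%2≡0 : ∀ m → 2 * m % 2 ≡ 0
2*m%2≡0 m = trans (cong (_% 2) (*-comm 2 m)) (m*n%n≡0 m 2)

[1+2*m]%2≡1 : ∀ m → (1 + 2 * m) % 2 ≡ 1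
[1+2*m]%2≡1 m = trans (cong (λ n → (1 + n) % 2) (*-comm 2 m)) ([m+kn]%n≡m%n 1 m 2)

2*m/2≡m : ∀ m → 2 * m / 2 ≡ m
2*m/2≡m m = trans (cong (_/ 2) (*-comm 2 m)) (m*n/n≡m m 2)

pfAux-even : ∀ f b m → pfAux (suc f) b (2 * m) ≡ pfAux f (b ∘ suc) m
pfAux-even f b m rewrite 2*m%2≡0 m | 2*m/2≡m m = refl

pfAux-odd : ∀ f b m → pfAux (suc f) b (1 + 2 * m) ≡ ((1 + 2 * m) % 4 ≡ᵇ twoPlus (b 0))
pfAux-odd f b m rewrite [1+2*m]%2≡1 m = refl

n≤pred[2n] : ∀ m → suc m ≤ pred (2 * suc m)
n≤pred[2n] m = subst (_≤ m + suc (m + 0)) (cong suc (+-identityʳ m)) (m≤n+m (suc (m + 0)) m)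

pfAux-fuel : ∀ f f′ b i → 1 ≤ i → i ≤ f → i ≤ f′ → pfAux f b i ≡ pfAux f′ b i
pfAux-fuel zero _ b (suc i) _ () _
pfAux-fuel (suc f) zero b (suc i) _ _ ()
pfAux-fuel (suc f) (suc f′) b i 1≤i i≤f i≤f′ with evenOdd i
... | odd m = trans (pfAux-odd f b m) (sym (pfAux-odd f′ b m))
... | even (suc m) = begin
  pfAux (suc f) b (2 * suc m)    ≡⟨ pfAux-even f b (suc m) ⟩
  pfAux f (b ∘ suc) (suc m)      ≡⟨ pfAux-fuel f f′ (b ∘ suc) (suc m) z<s (half i≤f) (half i≤f′) ⟩
  pfAux f′ (b ∘ suc) (suc m)     ≡⟨ pfAux-even f′ b (suc m) ⟨
  pfAux (suc f′) b (2 * suc m)   ∎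
  where
    half : ∀ {g} → 2 * suc m ≤ suc g → suc m ≤ g
    half 2m≤ = ≤-trans (n≤pred[2n] m) (≤-pred 2m≤)

paperfolding-double : ∀ b m → paperfolding b (2 * suc m) ≡ paperfolding (b ∘ suc) (suc m)
paperfolding-double b m =
  trans (pfAux-even _ b (suc m)) (pfAux-fuel _ _ (b ∘ suc) (suc m) z<s (n≤pred[2n] m) ≤-refl)

paperfolding-odd : ∀ b m → paperfolding b (1 + 2 * m) ≡ ((1 + 2 * m) % 4 ≡ᵇ twoPlus (b 0))
paperfolding-odd b m = pfAux-odd (2 * m) b m

regularPF-double : ∀ n .{{_ : NonZero n}} → regularPF (2 * n) ≡ regularPF n
regularPF-double (suc m) = paperfolding-double (λ _ → plus) m

regularPF-2^k* : ∀ k n .{{_ : NonZero n}} → regularPF (2 ^ k * n) ≡ regularPF n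
regularPF-2^k* zero n = cong regularPF (+-identityʳ n)
regularPF-2^k* (suc k) n = begin
  regularPF (2 * 2 ^ k * n)    ≡⟨ cong regularPF (*-assoc 2 (2 ^ k) n) ⟩
  regularPF (2 * (2 ^ k * n))  ≡⟨ regularPF-double (2 ^ k * n) {{m*n≢0 (2 ^ k) n {{m^n≢0 2 k}}}} ⟩
  regularPF (2 ^ k * n)        ≡⟨ regularPF-2^k* k n ⟩
  regularPF n                  ∎

regularPF-odd : ∀ m → regularPF (1 + 2 * m) ≡ ((1 + 2 * m) % 4 ≡ᵇ 3)
regularPF-odd = paperfolding-odd (λ _ → plus)

regularPF-odd-shift : ∀ m c → regularPF (1 + 2 * m + 2 * (2 * c)) ≡ regularPF (1 + 2 * m)
regularPF-odd-shift m c = begin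
  regularPF (1 + 2 * m + 2 * (2 * c))  ≡⟨ cong regularPF (odd-form m c) ⟩
  regularPF (1 + 2 * (m + 2 * c))      ≡⟨ regularPF-odd (m + 2 * c) ⟩
  ((1 + 2 * (m + 2 * c)) % 4 ≡ᵇ 3)     ≡⟨ cong (λ n → n % 4 ≡ᵇ 3) (multiple-form m c) ⟩
  ((1 + 2 * m + c * 4) % 4 ≡ᵇ 3)       ≡⟨ cong (_≡ᵇ 3) ([m+kn]%n≡m%n (1 + 2 * m) c 4) ⟩
  ((1 + 2 * m) % 4 ≡ᵇ 3)               ≡⟨ regularPF-odd m ⟨
  regularPF (1 + 2 * m)                ∎
  where
    odd-form : ∀ m c → 1 + 2 * m + 2 * (2 * c) ≡ 1 + 2 * (m + 2 * c)
    odd-form = solve-∀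
    multiple-form : ∀ m c → 1 + 2 * (m + 2 * c) ≡ 1 + 2 * m + c * 4
    multiple-form = solve-∀

regularPF-odd-alternates : ∀ m → regularPF (1 + 2 * suc m) ≢ regularPF (1 + 2 * m)
regularPF-odd-alternates zero ()
regularPF-odd-alternates (suc zero) ()
regularPF-odd-alternates (suc (suc m)) eq = regularPF-odd-alternates m (begin
  regularPF (1 + 2 * suc m)          ≡⟨ regularPF-odd-shift (suc m) 1 ⟨
  regularPF (1 + 2 * suc m + 4)      ≡⟨ cong regularPF (shift-form m) ⟩
  regularPF (1 + 2 * suc (suc (suc m)))  ≡⟨ eq ⟩
  regularPF (1 + 2 * suc (suc m))    ≡⟨ cong regularPF (shift-form′ m) ⟨
  regularPF (1 + 2 * m + 4)          ≡⟨ regularPF-odd-shift m 1 ⟩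
  regularPF (1 + 2 * m)              ∎)
  where
    shift-form : ∀ m → 1 + 2 * suc m + 4 ≡ 1 + 2 * suc (suc (suc m))
    shift-form = solve-∀
    shift-form′ : ∀ m → 1 + 2 * m + 4 ≡ 1 + 2 * suc (suc m)
    shift-form′ = solve-∀

odd-multiple-suc : ∀ p j → p * (1 + 2 * j) + 2 * p ≡ p * (1 + 2 * suc j)
odd-multiple-suc = solve-∀

regularPF-oddMultiple-flip : ∀ k j →
  regularPF (2 ^ k * (1 + 2 * j) + 2 ^ suc k) ≢ regularPF (2 ^ k * (1 + 2 * j))
regularPF-oddMultiple-flip k j eq = regularPF-odd-alternates j (begin
  regularPF (1 + 2 * suc j)                    ≡⟨ regularPF-2^k* k (1 + 2 * suc j) ⟨
  regularPF (2 ^ k * (1 + 2 * suc j))          ≡⟨ cong regularPF (odd-multiple-suc (2 ^ k) j) ⟨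
  regularPF (2 ^ k * (1 + 2 * j) + 2 ^ suc k)  ≡⟨ eq ⟩
  regularPF (2 ^ k * (1 + 2 * j))              ≡⟨ regularPF-2^k* k (1 + 2 * j) ⟩
  regularPF (1 + 2 * j)                        ∎)

Φ-injective₂ : ∀ {a a′ b b′} → a ≡ a′ → Φ a b ≡ Φ a′ b′ → b ≡ b′
Φ-injective₂ {false} {_} {false} {false} refl _ = refl
Φ-injective₂ {false} {_} {true}  {true}  refl _ = refl
Φ-injective₂ {true}  {_} {false} {false} refl _ = refl
Φ-injective₂ {true}  {_} {true}  {true}  refl _ = refl
Φ-injective₂ {false} {_} {false} {true}  refl ()
Φ-injective₂ {false} {_} {true}  {false} refl ()
Φ-injective₂ {true}  {_} {false} {true}  refl ()
Φ-injective₂ {true}  {_} {true}  {false} refl ()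

Φ-injective₁ : ∀ {a a′ b b′} → b ≡ b′ → Φ a b ≡ Φ a′ b′ → a ≡ a′
Φ-injective₁ {false} {false} {_} {_} refl _ = refl
Φ-injective₁ {true}  {true}  {_} {_} refl _ = refl
Φ-injective₁ {false} {true}  {false} {_} refl ()
Φ-injective₁ {false} {true}  {true}  {_} refl ()
Φ-injective₁ {true}  {false} {false} {_} refl ()
Φ-injective₁ {true}  {false} {true}  {_} refl ()

PositionShifts : ℕ → ℕ → Set
PositionShifts D p = regularPF (p + D) ≡ regularPF p

adjacentLetter : ℕ → XYZ
adjacentLetter a = Φ (regularPF a) (regularPF (suc a))

-- Of two adjacent positions one is odd, and odd positions are invariant under shifts by
-- multiples of 4; Φ then transfers the invariance to the other position.
adjacent-shift : ∀ a c → adjacentLetter (a + 2 * (2 * c)) ≡ adjacentLetter a →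
  PositionShifts (2 * (2 * c)) a × PositionShifts (2 * (2 * c)) (suc a)
adjacent-shift a c eq with evenOdd a
... | odd m  = regularPF-odd-shift m c , Φ-injective₂ (regularPF-odd-shift m c) eq
... | even m = Φ-injective₁ (regularPF-odd-shift m c) eq , regularPF-odd-shift m c

pairLetter : ℕ → ℕ → XYZ
pairLetter ℓ i = Φ (regularPF (ℓ + 2 * i + 1)) (regularPF (ℓ + 2 * i + 2))

pairLetter-adjacent : ∀ ℓ i → pairLetter ℓ i ≡ adjacentLetter (ℓ + 2 * i + 1)
pairLetter-adjacent ℓ i = cong (Φ (regularPF (ℓ + 2 * i + 1)) ∘ regularPF) (second-position ℓ i)
  where
    second-position : ∀ ℓ i → ℓ + 2 * i + 2 ≡ suc (ℓ + 2 * i + 1)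
    second-position = solve-∀

pairLetter-shift : ∀ ℓ i c → pairLetter ℓ (i + 2 * c) ≡ adjacentLetter (ℓ + 2 * i + 1 + 2 * (2 * c))
pairLetter-shift ℓ i c = trans (pairLetter-adjacent ℓ (i + 2 * c)) (cong adjacentLetter (first-position ℓ i c))
  where
    first-position : ∀ ℓ i c → ℓ + 2 * (i + 2 * c) + 1 ≡ ℓ + 2 * i + 1 + 2 * (2 * c)
    first-position = solve-∀

PairSquare : ℕ → ℕ → Set
PairSquare ℓ N = ∀ i → i < N → pairLetter ℓ (i + N) ≡ pairLetter ℓ i

pairSquare⇒pair-shifts : ∀ ℓ c → PairSquare ℓ (2 * c) → ∀ i → i < 2 * c →
  PositionShifts (2 * (2 * c)) (ℓ + 2 * i + 1) × PositionShifts (2 * (2 * c)) (suc (ℓ + 2 * i + 1))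
pairSquare⇒pair-shifts ℓ c square i i< = adjacent-shift (ℓ + 2 * i + 1) c (begin
  adjacentLetter (ℓ + 2 * i + 1 + 2 * (2 * c))  ≡⟨ pairLetter-shift ℓ i c ⟨
  pairLetter ℓ (i + 2 * c)                      ≡⟨ square i i< ⟩
  pairLetter ℓ i                                ≡⟨ pairLetter-adjacent ℓ i ⟩
  adjacentLetter (ℓ + 2 * i + 1)                ∎)

pairSquare⇒position-shifts : ∀ ℓ c → PairSquare ℓ (2 * c) →
  ∀ d → 1 ≤ d → d ≤ 2 * (2 * c) → PositionShifts (2 * (2 * c)) (ℓ + d)
pairSquare⇒position-shifts ℓ c square (suc e) _ d≤ with evenOdd e
... | even i = subst (PositionShifts _) (position₁ ℓ i)
                 (proj₁ (pairSquare⇒pair-shifts ℓ c square i (*-cancelˡ-< 2 i (2 * c) d≤)))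
  where
    position₁ : ∀ ℓ i → ℓ + 2 * i + 1 ≡ ℓ + suc (2 * i)
    position₁ = solve-∀
... | odd i  = subst (PositionShifts _) (position₂ ℓ i)
                 (proj₂ (pairSquare⇒pair-shifts ℓ c square i (*-cancelˡ-< 2 i (2 * c) (≤-trans (n≤1+n _) d≤))))
  where
    position₂ : ∀ ℓ i → suc (ℓ + 2 * i + 1) ≡ ℓ + suc (1 + 2 * i)
    position₂ = solve-∀

oddMultiple-window : ∀ N ℓ .{{_ : NonZero N}} → ∃[ d ] ∃[ j ] 1 ≤ d × d ≤ 2 * N × ℓ + d ≡ N * (1 + 2 * j)
oddMultiple-window N zero = N , 0 , >-nonZero⁻¹ N , m≤m+n N (N + 0) , sym (*-identityʳ N)
oddMultiple-window N (suc ℓ) with oddMultiple-window N ℓ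
... | suc (suc d) , j , _ , d≤ , eq = suc d , j , s≤s z≤n , ≤-trans (n≤1+n _) d≤ , trans (sym (+-suc ℓ (suc d))) eq
... | 1 , j , _ , _ , eq = 2 * N , suc j , ≤-trans (>-nonZero⁻¹ N) (m≤m+n N (N + 0)) , ≤-refl , (begin
  suc ℓ + 2 * N          ≡⟨ cong (_+ 2 * N) (+-comm 1 ℓ) ⟩
  ℓ + 1 + 2 * N          ≡⟨ cong (_+ 2 * N) eq ⟩
  N * (1 + 2 * j) + 2 * N  ≡⟨ odd-multiple-suc N j ⟩
  N * (1 + 2 * suc j)    ∎)

pairSquare-impossible : ∀ k ℓ → ¬ PairSquare ℓ (2 ^ suc k)
pairSquare-impossible k ℓ square with oddMultiple-window (2 ^ suc k) ℓ {{m^n≢0 2 (suc k)}}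
... | d , j , 1≤d , d≤ , ℓ+d≡ = regularPF-oddMultiple-flip (suc k) j
        (subst (PositionShifts (2 ^ suc (suc k))) ℓ+d≡ (pairSquare⇒position-shifts ℓ (2 ^ k) square d 1≤d d≤))

Period : {A : Set} → (ℕ → A) → ℕ → Set
Period f p = ∀ j → f (j + p) ≡ f j

period-* : ∀ {A : Set} {f : ℕ → A} {p} → Period f p → ∀ t → Period f (t * p)
period-* {f = f} per zero j = cong f (+-identityʳ j)
period-* {f = f} {p} per (suc t) j = begin
  f (j + (p + t * p))  ≡⟨ cong f (+-assoc j p (t * p)) ⟨
  f (j + p + t * p)    ≡⟨ period-* per t (j + p) ⟩
  f (j + p)            ≡⟨ per j ⟩
  f j                  ∎

period-cancelʳ : ∀ {A : Set} {f : ℕ → A} {p p′} → Period f (p + p′) → Period f p′ → Period f p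
period-cancelʳ {f = f} {p} {p′} per per′ j = begin
  f (j + p)         ≡⟨ per′ (j + p) ⟨
  f (j + p + p′)    ≡⟨ cong f (+-assoc j p p′) ⟩
  f (j + (p + p′))  ≡⟨ per j ⟩
  f j               ∎

twoAdic : ∀ q → 1 ≤ q → ∃[ a ] ∃[ r ] q ≡ 2 ^ a * (1 + 2 * r)
twoAdic = <-rec _ decompose
  where
    decompose : ∀ q → (∀ {m} → m < q → 1 ≤ m → ∃[ a ] ∃[ r ] m ≡ 2 ^ a * (1 + 2 * r)) →
                1 ≤ q → ∃[ a ] ∃[ r ] q ≡ 2 ^ a * (1 + 2 * r)
    decompose q rec _ with evenOdd q
    ... | odd r = 0 , r , sym (+-identityʳ (1 + 2 * r))
    ... | even (suc m) with rec (m<m+n (suc m) z<s) z<s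
    ...   | a , r , eq = suc a , r , (begin
      2 * suc m                  ≡⟨ cong (2 *_) eq ⟩
      2 * (2 ^ a * (1 + 2 * r))  ≡⟨ *-assoc 2 (2 ^ a) (1 + 2 * r) ⟨
      2 ^ suc a * (1 + 2 * r)    ∎)

-- For q = 2^a·(2r+1) with a ≤ K, the multiple 2^(K−a)·q equals 2^K + r·2^(K+1).
period-2^-half : ∀ {A : Set} {f : ℕ → A} K {q} → Period f (2 ^ suc K) → Period f q → 1 ≤ q → q < 2 ^ suc K →
  Period f (2 ^ K)
period-2^-half {f = f} K {q} per perq 1≤q q< with twoAdic q 1≤q
... | a , r , q≡ = period-cancelʳ (subst (Period f) multiple≡ (period-* perq (2 ^ (K ∸ a)))) (period-* per r)
  where
    a≤K : a ≤ K
    a≤K = ≮⇒≥ λ K<a → <⇒≱ q<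
      (≤-trans (^-monoʳ-≤ 2 K<a) (≤-trans (m≤m*n (2 ^ a) (1 + 2 * r)) (≤-reflexive (sym q≡))))
    multiple≡ : 2 ^ (K ∸ a) * q ≡ 2 ^ K + r * 2 ^ suc K
    multiple≡ = begin
      2 ^ (K ∸ a) * q                    ≡⟨ cong (2 ^ (K ∸ a) *_) q≡ ⟩
      2 ^ (K ∸ a) * (2 ^ a * (1 + 2 * r))  ≡⟨ *-assoc (2 ^ (K ∸ a)) (2 ^ a) (1 + 2 * r) ⟨
      2 ^ (K ∸ a) * 2 ^ a * (1 + 2 * r)    ≡⟨ cong (_* (1 + 2 * r)) (^-distribˡ-+-* 2 (K ∸ a) a) ⟨
      2 ^ (K ∸ a + a) * (1 + 2 * r)        ≡⟨ cong (λ e → 2 ^ e * (1 + 2 * r)) (m∸n+n≡m a≤K) ⟩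
      2 ^ K * (1 + 2 * r)                  ≡⟨ split (2 ^ K) r ⟩
      2 ^ K + r * 2 ^ suc K                ∎
      where
        split : ∀ p r → p * (1 + 2 * r) ≡ p + r * (2 * p)
        split = solve-∀

applyUpTo-++ : ∀ {A : Set} (f : ℕ → A) m n → applyUpTo f m ++ applyUpTo (f ∘ (m +_)) n ≡ applyUpTo f (m + n)
applyUpTo-++ f zero    n = refl
applyUpTo-++ f (suc m) n = cong (f 0 ∷_) (applyUpTo-++ (f ∘ suc) m n)

drop-applyUpTo : ∀ {A : Set} (f : ℕ → A) m n → drop m (applyUpTo f n) ≡ applyUpTo (f ∘ (m +_)) (n ∸ m)
drop-applyUpTo f zero    n       = refl
drop-applyUpTo f (suc m) zero    = refl
drop-applyUpTo f (suc m) (suc n) = drop-applyUpTo (f ∘ suc) m n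

take-applyUpTo : ∀ {A : Set} (f : ℕ → A) m n → m ≤ n → take m (applyUpTo f n) ≡ applyUpTo f m
take-applyUpTo f zero    n       _         = refl
take-applyUpTo f (suc m) (suc n) (s≤s m≤n) = cong (f 0 ∷_) (take-applyUpTo (f ∘ suc) m n m≤n)

applyUpTo-cong : ∀ {A : Set} {f g : ℕ → A} n → (∀ i → i < n → f i ≡ g i) → applyUpTo f n ≡ applyUpTo g n
applyUpTo-cong zero    _  = refl
applyUpTo-cong (suc n) eq = cong₂ _∷_ (eq 0 z<s) (applyUpTo-cong n (λ i i<n → eq (suc i) (s<s i<n)))

applyUpTo-cong⁻¹ : ∀ {A : Set} (f g : ℕ → A) n → applyUpTo f n ≡ applyUpTo g n → ∀ i → i < n → f i ≡ g i
applyUpTo-cong⁻¹ f g (suc n) eq zero    _         = proj₁ (∷-injective eq)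
applyUpTo-cong⁻¹ f g (suc n) eq (suc i) (s<s i<n) = applyUpTo-cong⁻¹ (f ∘ suc) (g ∘ suc) n (proj₂ (∷-injective eq)) i i<n

cyclic : {A : Set} → (ℕ → A) → (M : ℕ) → .{{NonZero M}} → ℕ → A
cyclic f M j = f (j % M)

cyclic-period : ∀ {A : Set} (f : ℕ → A) M .{{_ : NonZero M}} → Period (cyclic f M) M
cyclic-period f M j = cong f ([m+n]%n≡m%n j M)

cyclic-< : ∀ {A : Set} (f : ℕ → A) M .{{_ : NonZero M}} {j} → j < M → cyclic f M j ≡ f j
cyclic-< f M j<M = cong f (m<n⇒m%n≡m j<M)

rotation⇒period : ∀ {A : Set} (f : ℕ → A) M .{{_ : NonZero M}} q → q < M →
  let w = map f (upTo M) in w ≡ drop q w ++ take q w → Period (cyclic f M) q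
rotation⇒period f M q q<M rotated j = begin
  f ((j + q) % M)          ≡⟨ cong f (%-absorbˡ j) ⟨
  f ((j % M + q) % M)      ≡⟨ agrees (j % M) (m%n<n j M) ⟨
  f (j % M)                ∎
  where
    rotate : ℕ → _
    rotate i = f ((i + q) % M)
    w = map f (upTo M)
    %-absorbˡ : ∀ j → (j % M + q) % M ≡ (j + q) % M
    %-absorbˡ j = begin
      (j % M + q) % M            ≡⟨ %-distribˡ-+ (j % M) q M ⟩
      (j % M % M + q % M) % M    ≡⟨ cong (λ n → (n + q % M) % M) (m%n%n≡m%n j M) ⟩
      (j % M + q % M) % M        ≡⟨ %-distribˡ-+ j q M ⟨
      (j + q) % M                ∎
    front : ∀ i → i < M ∸ q → f (q + i) ≡ rotate i
    front i i< = cong f (trans (+-comm q i) (sym (m<n⇒m%n≡m (m≤o∸n⇒m+n≤o (suc i) (<⇒≤ q<M) i<))))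
    rearrange : ∀ a i q → a + i + q ≡ i + (a + q)
    rearrange = solve-∀
    back : ∀ i → i < q → f i ≡ rotate (M ∸ q + i)
    back i i<q = cong f (sym (begin
      (M ∸ q + i + q) % M    ≡⟨ cong (_% M) (rearrange (M ∸ q) i q) ⟩
      (i + (M ∸ q + q)) % M  ≡⟨ cong (λ n → (i + n) % M) (m∸n+n≡m (<⇒≤ q<M)) ⟩
      (i + M) % M            ≡⟨ [m+n]%n≡m%n i M ⟩
      i % M                  ≡⟨ m<n⇒m%n≡m (<-trans i<q q<M) ⟩
      i                      ∎))
    agrees : ∀ i → i < M → f i ≡ rotate i
    agrees = applyUpTo-cong⁻¹ f rotate M (begin
      applyUpTo f M                                           ≡⟨ map-upTo f M ⟨
      w                                                       ≡⟨ rotated ⟩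
      drop q w ++ take q w                                    ≡⟨ cong (λ v → drop q v ++ take q v) (map-upTo f M) ⟩
      drop q (applyUpTo f M) ++ take q (applyUpTo f M)        ≡⟨ cong₂ _++_ (drop-applyUpTo f q M) (take-applyUpTo f q M (<⇒≤ q<M)) ⟩
      applyUpTo (f ∘ (q +_)) (M ∸ q) ++ applyUpTo f q         ≡⟨ cong₂ _++_ (applyUpTo-cong (M ∸ q) front) (applyUpTo-cong q back) ⟩
      applyUpTo rotate (M ∸ q) ++ applyUpTo (rotate ∘ (M ∸ q +_)) q  ≡⟨ applyUpTo-++ rotate (M ∸ q) q ⟩
      applyUpTo rotate (M ∸ q + q)                            ≡⟨ cong (applyUpTo rotate) (m∸n+n≡m (<⇒≤ q<M)) ⟩
      applyUpTo rotate M                                      ∎)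

cyclic-halfPeriod⇒square : ∀ {A : Set} (f : ℕ → A) N .{{_ : NonZero (2 * N)}} →
  Period (cyclic f (2 * N)) N → ∀ i → i < N → f (i + N) ≡ f i
cyclic-halfPeriod⇒square f N period i i<N = begin
  f (i + N)               ≡⟨ cyclic-< f (2 * N) (<-≤-trans (+-monoˡ-< N i<N) N+N≤2N) ⟨
  cyclic f (2 * N) (i + N)  ≡⟨ period i ⟩
  cyclic f (2 * N) i        ≡⟨ cyclic-< f (2 * N) (<-≤-trans i<N (m≤m+n N (N + 0))) ⟩
  f i                     ∎
  where
    N+N≤2N : N + N ≤ 2 * N
    N+N≤2N = ≤-reflexive (cong (N +_) (sym (+-identityʳ N)))

mainTheorem3 : (n ℓ q : ℕ) → 3 ≤ n → 1 ≤ q → q < 2 ^ (n ∸ 1) →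
    ¬ (phiWord ℓ (2 ^ (n ∸ 1)) ≡ drop q (phiWord ℓ (2 ^ (n ∸ 1))) ++ take q (phiWord ℓ (2 ^ (n ∸ 1))))
mainTheorem3 (suc (suc (suc k))) ℓ q (s≤s (s≤s (s≤s _))) 1≤q q<M rotated =
  pairSquare-impossible k ℓ (cyclic-halfPeriod⇒square (pairLetter ℓ) N halfPeriod)
  where
    N = 2 ^ suc k
    M = 2 * N
    instance
      M≢0 : NonZero M
      M≢0 = m^n≢0 2 (suc (suc k))
    halfPeriod : Period (cyclic (pairLetter ℓ) M) N
    halfPeriod = period-2^-half (suc k) (cyclic-period (pairLetter ℓ) M)
                   (rotation⇒period (pairLetter ℓ) M q q<M rotated) 1≤q q<M
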